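{- Let $q$ be an odd prime, let $H$ be the parity-check matrix of a proper array code (PAC) with modulus $q$ consisting of four block-rows, and let $A$ be the $4q\times mq$ matrix obtained by deleting some $q-m$ block-columns from $H$. Then the shortened array code with parity-check matrix $A$ has girth at least eight if and only if the sequence of block-column labels in $A$ is both non-averaging over $\mathbb{Z}_q$ and $2$-non-averaging over $\mathbb{Z}_q$.
   Context: For integers $a\le b$, $[a,b]=\{x\in\mathbb{Z}: a\le x\le b\}$. Let $q$ be an odd prime, $I$ the $q\times q$ identity matrix and $P\ne I$ a $q\times q$ circulant permutation matrix. Given $r\in[1,q]$ and distinct integers $a_0,\dots,a_{r-1}\in[0,q-1]$, the array code with modulus $q$ has parity-check matrix $H$ formed by an $r\times q$ array of $q\times q$ blocks, the block in block-row $i\in[0,r-1]$ and block-column $j\in[0,q-1]$ being $P^{a_i\cdot j}$; it is a proper array code (PAC) if $a_0,\dots,a_{r-1}$ is an arithmetic progression with nonzero common difference. The label of a block-column is its index $j$ in $H$; retained block-columns keep their labels after deletion. The girth of a code is the length of a shortest cycle in its Tanner graph (the bipartite graph with a vertex for each column and each row of the parity-check matrix, column and row vertices adjacent iff the corresponding entry is $1$). For a positive integer $c$, a sequence $n_1,n_2,\dots$ of distinct integers in $[0,N-1]$ is $c$-non-averaging over $\mathbb{Z}_N$ if $n_i+c\,n_j\equiv (c+1)n_k \pmod N$ implies $i=j=k$; it is non-averaging over $\mathbb{Z}_N$ if it is $1$-non-averaging over $\mathbb{Z}_N$, i.e. $n_i+n_j\equiv 2n_k\pmod N$ implies $i=j=k$.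 -}

module Defs where

open import Data.Nat as ℕ using (ℕ; zero; suc; _≤_; _<_)
open import Data.Integer as ℤ using (ℤ; +_; _-_)
open import Data.Integer.Divisibility using (_∣_)
open import Data.Fin using (Fin; toℕ)
open import Data.Product using (_×_)
open import Data.Sum using (_⊎_; inj₁; inj₂)
open import Data.Empty using (⊥)
open import Relation.Binary.PropositionalEquality using (_≡_)

infix 4 _≡_[mod_]
_≡_[mod_] : ℤ → ℤ → ℕ → Set
x ≡ y [mod q ] = (+ q) ∣ (x - y)

record Cycle {V : Set} (Adj : V → V → Set) (ℓ : ℕ) : Set where
  field
    three≤ℓ : 3 ≤ ℓ
    vert    : Fin ℓ → V
    inj     : ∀ i j → vert i ≡ vert j → i ≡ j
    step    : ∀ i j → toℕ j ≡ suc (toℕ i) → Adj (vert i) (vert j)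
    close   : ∀ i j → toℕ i ≡ ℓ ℕ.∸ 1 → toℕ j ≡ 0 → Adj (vert i) (vert j)

GirthAtLeast : {V : Set} → (V → V → Set) → ℕ → Set
GirthAtLeast Adj g = ∀ ℓ → Cycle Adj ℓ → g ≤ ℓ

TannerAdj : {R C : Set} → (R → C → Set) → (C ⊎ R) → (C ⊎ R) → Set
TannerAdj M (inj₁ c) (inj₁ c') = ⊥
TannerAdj M (inj₁ c) (inj₂ r)  = M r c
TannerAdj M (inj₂ r) (inj₁ c)  = M r c
TannerAdj M (inj₂ r) (inj₂ r') = ⊥

-- Entry (u,v) of P^e, where P is the q×q circulant permutation matrix with
-- shift s (P_{u,v} = 1 iff v ≡ u + s mod q); P^e is the circulant
-- permutation matrix with shift e·s.
CircPow : (q s e : ℕ) → Fin q → Fin q → Set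
CircPow q s e u v = (+ toℕ v) ≡ ((+ toℕ u) ℤ.+ (+ (e ℕ.* s))) [mod q ]

-- The shortened array code matrix A: block-rows i ∈ [0,3] with parameters
-- a i, retained block-columns with labels L k (k ∈ [0,m-1]); the block in
-- block-row i and the block-column with label j is P^(a i · j).
ShortenedArray : (q s : ℕ) (a : Fin 4 → ℕ) {m : ℕ} (L : Fin m → Fin q)
               → (Fin 4 × Fin q) → (Fin m × Fin q) → Set
ShortenedArray q s a L (i Data.Product., u) (k Data.Product., v) =
  CircPow q s (a i ℕ.* toℕ (L k)) u v

ProperAP : (a : Fin 4 → ℕ) → Set
ProperAP a = Data.Product.Σ ℤ λ d → (d ≡ ℤ.0ℤ → ⊥) ×
  (∀ i → (+ a i) ≡ (+ a Fin.zero) ℤ.+ (+ toℕ i) ℤ.* d)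
  where import Data.Fin as Fin

StrictlyIncreasing : {m q : ℕ} → (Fin m → Fin q) → Set
StrictlyIncreasing {m} L = ∀ (k k' : Fin m) → toℕ k < toℕ k' → toℕ (L k) < toℕ (L k')

NonAveraging[_] : (c N : ℕ) {m : ℕ} → (Fin m → ℕ) → Set
NonAveraging[ c ] N {m} n = ∀ (i j k : Fin m) →
  ((+ n i) ℤ.+ (+ c) ℤ.* (+ n j)) ≡ ((+ suc c) ℤ.* (+ n k)) [mod N ] →
  (i ≡ j) × (j ≡ k)

NonAveraging : (N : ℕ) {m : ℕ} → (Fin m → ℕ) → Set
NonAveraging N n = NonAveraging[ 1 ] N n

-- Every block of the parity-check matrix is a circulant permutation matrix, so in the
-- Tanner graph a cycle alternates between block-rows and block-columns, and telescoping the
-- defining congruences shows that a 2n-cycle through blocks exists iff the alternating sum of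
-- the exponents vanishes mod q.  The graph is bipartite, so girth ≥ 8 means: no 4- and no
-- 6-cycles.  With exponents s·a_i·j the 4-cycle sum factors as s (a_i − a_i′)(j − j′), which the
-- prime q never divides.  Writing a_i = a₀ + t_i d, the 6-cycle sum is s d Σ ℓ_j (t_j − t_{j−1});
-- rotating and reversing the cycle until t₀ < t₁ < t₂ turns it into a ℓ₁ + b ℓ₂ − (a+b) ℓ₀ with
-- a, b ≥ 1 and a + b ≤ 3, i.e. a 1- or 2-averaging relation between three distinct labels.
-- Conversely such a relation closes a 6-cycle through the block-rows 1, 1 + c, 0.
module Submission where

open import Defs
open import Data.Nat using (ℕ; _≤_; _<_)
open import Data.Nat.Divisibility using (_∣_)
open import Data.Nat.Primality using (Prime)
open import Data.Integer using (ℤ)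
open import Data.Fin using (Fin; toℕ)
open import Data.Product using (_×_)
open import Data.Sum using (_⊎_)
open import Function using (_∘_)
open import Function.Bundles using (_⇔_)
open import Relation.Nullary using (¬_)

open import Data.Nat as ℕ using (zero; suc; s≤s; z≤n; NonZero; >-nonZero)
open import Data.Nat.Properties
  using (<⇒≱; ⊔-lub; ≤-<-trans; <-irrefl; <-cmp; <-trans; m≤n+m; +-assoc; ≤-trans; ≤-refl; +-suc;
         n≮n; m<n⇒m<1+n; m≤n⇒∃[o]m+o≡n)
open import Data.Nat.Divisibility using (∣⇒≤; >⇒∤)
open import Data.Nat.GeneralisedArithmetic using (fold)
open import Data.Nat.Primality using (euclidsLemma; prime⇒nonZero)
open import Data.Integer as ℤ using (+_; _+_; _-_; -_; _*_; ∣_∣; ≢-nonZero)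
open import Data.Integer.Properties
  using (+-injective; ∣i∣≡0⇒i≡0; i-j≡0⇒i≡j; [+m]-[+n]≡m⊖n; ∣m⊝n∣≤m⊔n; abs-*; *-cancelʳ-≡; pos-*)
open import Data.Integer.Divisibility.Signed
  using (∣ᵤ⇒∣; ∣⇒∣ᵤ; ∣m∣n⇒∣m+n; ∣m∣n⇒∣m-n; ∣m⇒∣-m; ∣n⇒∣m*n; ∣-refl; ∣m+n∣m⇒∣n; ∣m+n∣n⇒∣m)
  renaming (_∣_ to _∣ℤ_)
open import Data.Integer.DivMod using (_%ℕ_; _/ℕ_; n%ℕd<d; a≡a%ℕn+[a/ℕn]*n)
open import Data.Integer.Tactic.RingSolver using (solve-∀)
open import Data.Fin using (fromℕ<; _≟_)
open import Data.Fin.Patterns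
open import Data.Fin.Properties using (toℕ-injective; toℕ-fromℕ<; toℕ<n; injective⇒≤)
open import Data.Vec using (Vec; _∷_; []; lookup)
open import Data.Vec.Relation.Unary.Unique.Propositional using (Unique)
open import Data.Vec.Relation.Unary.Unique.Propositional.Properties using (lookup-injective)
open import Data.Vec.Relation.Unary.All using (_∷_; [])
open import Data.Vec.Relation.Unary.AllPairs using (_∷_; [])
open import Data.Bool using (Bool; true; false; not)
open import Data.Bool.Properties using (not-¬; not-involutive)
open import Data.Product using (_,_; proj₁; proj₂; uncurry)
open import Data.Sum using (inj₁; inj₂)
open import Data.Sum.Properties using (inj₁-injective; inj₂-injective)
open import Function.Bundles using (mk⇔)
open import Relation.Nullary using (yes; no; contradiction)
open import Relation.Binary.Definitions using (tri<; tri≈; tri>)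
open import Relation.Binary.PropositionalEquality

m∣n∧n<m⇒n≡0 : ∀ {q n} → q ∣ n → n < q → n ≡ 0
m∣n∧n<m⇒n≡0 {n = zero}  _   _   = refl
m∣n∧n<m⇒n≡0 {n = suc _} q∣n n<q = contradiction (∣⇒≤ q∣n) (<⇒≱ n<q)

≡[mod]⇒≡ : ∀ {q x y} → x < q → y < q → + x ≡ + y [mod q ] → x ≡ y
≡[mod]⇒≡ {q} {x} {y} x<q y<q q∣x-y = +-injective (i-j≡0⇒i≡j (+ x) (+ y) (∣i∣≡0⇒i≡0 (m∣n∧n<m⇒n≡0 q∣x-y distance<q)))
  where
  distance<q : ∣ + x - + y ∣ < q
  distance<q rewrite [+m]-[+n]≡m⊖n x y = ≤-<-trans (∣m⊝n∣≤m⊔n x y) (⊔-lub x<q y<q)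

prime-∣-* : ∀ {q} → Prime q → ∀ x y → + q ∣ℤ x * y → + q ∣ℤ x ⊎ + q ∣ℤ y
prime-∣-* {q} isPrime x y q∣xy with euclidsLemma ∣ x ∣ ∣ y ∣ isPrime (subst (q ∣_) (abs-* x y) (∣⇒∣ᵤ q∣xy))
... | inj₁ q∣x = inj₁ (∣ᵤ⇒∣ q∣x)
... | inj₂ q∣y = inj₂ (∣ᵤ⇒∣ q∣y)

prime-∤-* : ∀ {q} → Prime q → ∀ {x y} → ¬ + q ∣ℤ x → ¬ + q ∣ℤ y → ¬ + q ∣ℤ x * y
prime-∤-* isPrime {x} {y} q∤x q∤y q∣xy with prime-∣-* isPrime x y q∣xy
... | inj₁ q∣x = q∤x q∣x
... | inj₂ q∣y = q∤y q∣y

module TannerCycles {R C : Set} (M : R → C → Set) where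

  Adj : C ⊎ R → C ⊎ R → Set
  Adj = TannerAdj M

  record Rectangle : Set where
    field
      c₀ c₁ : C
      r₀ r₁ : R
      c₀≢c₁ : c₀ ≢ c₁
      r₀≢r₁ : r₀ ≢ r₁
      m₀₀ : M r₀ c₀
      m₀₁ : M r₀ c₁
      m₁₁ : M r₁ c₁
      m₁₀ : M r₁ c₀

  record Hexagon : Set where
    field
      c₀ c₁ c₂ : C
      r₀ r₁ r₂ : R
      c₀≢c₁ : c₀ ≢ c₁
      c₁≢c₂ : c₁ ≢ c₂
      c₂≢c₀ : c₂ ≢ c₀
      r₀≢r₁ : r₀ ≢ r₁
      r₁≢r₂ : r₁ ≢ r₂
      r₂≢r₀ : r₂ ≢ r₀
      m₀₀ : M r₀ c₀
      m₀₁ : M r₀ c₁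
      m₁₁ : M r₁ c₁
      m₁₂ : M r₁ c₂
      m₂₂ : M r₂ c₂
      m₂₀ : M r₂ c₀

  isColumn : C ⊎ R → Bool
  isColumn (inj₁ _) = true
  isColumn (inj₂ _) = false

  isColumn-flips : ∀ {x y} → Adj x y → isColumn y ≡ not (isColumn x)
  isColumn-flips {inj₁ _} {inj₂ _} _ = refl
  isColumn-flips {inj₂ _} {inj₁ _} _ = refl

  fold-not-even : ∀ b n → fold b not (n ℕ.+ n) ≡ b
  fold-not-even b zero    = refl
  fold-not-even b (suc n) rewrite +-suc n n = trans (not-involutive _) (fold-not-even b n)

  no-odd-cycle : ∀ n → ¬ Cycle Adj (suc (n ℕ.+ n))
  no-odd-cycle n cy =
    not-¬ (sym (fold-not-even b n)) (trans (isColumn-flips closing) (cong not (alternates (n ℕ.+ n) ≤-refl)))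
    where
    open Cycle cy
    b : Bool
    b = isColumn (vert 0F)
    alternates : ∀ k (k<ℓ : k < suc (n ℕ.+ n)) → isColumn (vert (fromℕ< k<ℓ)) ≡ fold b not k
    alternates zero    _           = refl
    alternates (suc k) (s≤s k<n+n) = trans
      (isColumn-flips (step _ _ (trans (toℕ-fromℕ< (s≤s k<n+n)) (cong suc (sym (toℕ-fromℕ< (m<n⇒m<1+n k<n+n)))))))
      (cong not (alternates k (m<n⇒m<1+n k<n+n)))
    closing : Adj (vert (fromℕ< (≤-refl {suc (n ℕ.+ n)}))) (vert 0F)
    closing = close _ _ (toℕ-fromℕ< ≤-refl) refl

  closed-walk⇒rectangle : ∀ x₀ x₁ x₂ x₃ → Adj x₀ x₁ → Adj x₁ x₂ → Adj x₂ x₃ → Adj x₃ x₀ →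
                          x₀ ≢ x₂ → x₁ ≢ x₃ → Rectangle
  closed-walk⇒rectangle (inj₁ c₀) (inj₂ r₀) (inj₁ c₁) (inj₂ r₁) a₀ a₁ a₂ a₃ x₀≢x₂ x₁≢x₃ =
    record { c₀≢c₁ = x₀≢x₂ ∘ cong inj₁ ; r₀≢r₁ = x₁≢x₃ ∘ cong inj₂
           ; m₀₀ = a₀ ; m₀₁ = a₁ ; m₁₁ = a₂ ; m₁₀ = a₃ }
  closed-walk⇒rectangle (inj₂ r₀) (inj₁ c₀) (inj₂ r₁) (inj₁ c₁) a₀ a₁ a₂ a₃ x₀≢x₂ x₁≢x₃ =
    record { c₀≢c₁ = x₁≢x₃ ∘ cong inj₁ ; r₀≢r₁ = x₀≢x₂ ∘ cong inj₂
           ; m₀₀ = a₀ ; m₀₁ = a₃ ; m₁₁ = a₂ ; m₁₀ = a₁ }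
  closed-walk⇒rectangle (inj₁ _) (inj₁ _) _ _ () _ _ _ _ _
  closed-walk⇒rectangle (inj₂ _) (inj₂ _) _ _ () _ _ _ _ _
  closed-walk⇒rectangle _ (inj₁ _) (inj₁ _) _ _ () _ _ _ _
  closed-walk⇒rectangle _ (inj₂ _) (inj₂ _) _ _ () _ _ _ _
  closed-walk⇒rectangle _ _ (inj₁ _) (inj₁ _) _ _ () _ _ _
  closed-walk⇒rectangle _ _ (inj₂ _) (inj₂ _) _ _ () _ _ _

  cycle⇒rectangle : Cycle Adj 4 → Rectangle
  cycle⇒rectangle cy = closed-walk⇒rectangle (vert 0F) (vert 1F) (vert 2F) (vert 3F)
    (step 0F 1F refl) (step 1F 2F refl) (step 2F 3F refl) (close 3F 0F refl refl)
    (λ e → contradiction (inj 0F 2F e) λ ()) (λ e → contradiction (inj 1F 3F e) λ ())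
    where open Cycle cy

  closed-walk⇒hexagon : ∀ x₀ x₁ x₂ x₃ x₄ x₅ →
    Adj x₀ x₁ → Adj x₁ x₂ → Adj x₂ x₃ → Adj x₃ x₄ → Adj x₄ x₅ → Adj x₅ x₀ →
    x₀ ≢ x₂ → x₂ ≢ x₄ → x₄ ≢ x₀ → x₁ ≢ x₃ → x₃ ≢ x₅ → x₅ ≢ x₁ → Hexagon
  closed-walk⇒hexagon (inj₁ c₀) (inj₂ r₀) (inj₁ c₁) (inj₂ r₁) (inj₁ c₂) (inj₂ r₂)
                      a₀ a₁ a₂ a₃ a₄ a₅ x₀≢x₂ x₂≢x₄ x₄≢x₀ x₁≢x₃ x₃≢x₅ x₅≢x₁ =
    record { c₀≢c₁ = x₀≢x₂ ∘ cong inj₁ ; c₁≢c₂ = x₂≢x₄ ∘ cong inj₁ ; c₂≢c₀ = x₄≢x₀ ∘ cong inj₁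
           ; r₀≢r₁ = x₁≢x₃ ∘ cong inj₂ ; r₁≢r₂ = x₃≢x₅ ∘ cong inj₂ ; r₂≢r₀ = x₅≢x₁ ∘ cong inj₂
           ; m₀₀ = a₀ ; m₀₁ = a₁ ; m₁₁ = a₂ ; m₁₂ = a₃ ; m₂₂ = a₄ ; m₂₀ = a₅ }
  closed-walk⇒hexagon (inj₂ r₂) (inj₁ c₀) (inj₂ r₀) (inj₁ c₁) (inj₂ r₁) (inj₁ c₂)
                      a₀ a₁ a₂ a₃ a₄ a₅ x₀≢x₂ x₂≢x₄ x₄≢x₀ x₁≢x₃ x₃≢x₅ x₅≢x₁ =
    record { c₀≢c₁ = x₁≢x₃ ∘ cong inj₁ ; c₁≢c₂ = x₃≢x₅ ∘ cong inj₁ ; c₂≢c₀ = x₅≢x₁ ∘ cong inj₁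
           ; r₀≢r₁ = x₂≢x₄ ∘ cong inj₂ ; r₁≢r₂ = x₄≢x₀ ∘ cong inj₂ ; r₂≢r₀ = x₀≢x₂ ∘ cong inj₂
           ; m₀₀ = a₁ ; m₀₁ = a₂ ; m₁₁ = a₃ ; m₁₂ = a₄ ; m₂₂ = a₅ ; m₂₀ = a₀ }
  closed-walk⇒hexagon (inj₁ _) (inj₁ _) _ _ _ _ () _ _ _ _ _ _ _ _ _ _ _
  closed-walk⇒hexagon (inj₂ _) (inj₂ _) _ _ _ _ () _ _ _ _ _ _ _ _ _ _ _
  closed-walk⇒hexagon _ (inj₁ _) (inj₁ _) _ _ _ _ () _ _ _ _ _ _ _ _ _ _
  closed-walk⇒hexagon _ (inj₂ _) (inj₂ _) _ _ _ _ () _ _ _ _ _ _ _ _ _ _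
  closed-walk⇒hexagon _ _ (inj₁ _) (inj₁ _) _ _ _ _ () _ _ _ _ _ _ _ _ _
  closed-walk⇒hexagon _ _ (inj₂ _) (inj₂ _) _ _ _ _ () _ _ _ _ _ _ _ _ _
  closed-walk⇒hexagon _ _ _ (inj₁ _) (inj₁ _) _ _ _ _ () _ _ _ _ _ _ _ _
  closed-walk⇒hexagon _ _ _ (inj₂ _) (inj₂ _) _ _ _ _ () _ _ _ _ _ _ _ _
  closed-walk⇒hexagon _ _ _ _ (inj₁ _) (inj₁ _) _ _ _ _ () _ _ _ _ _ _ _
  closed-walk⇒hexagon _ _ _ _ (inj₂ _) (inj₂ _) _ _ _ _ () _ _ _ _ _ _ _

  cycle⇒hexagon : Cycle Adj 6 → Hexagon
  cycle⇒hexagon cy = closed-walk⇒hexagon (vert 0F) (vert 1F) (vert 2F) (vert 3F) (vert 4F) (vert 5F)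
    (step 0F 1F refl) (step 1F 2F refl) (step 2F 3F refl) (step 3F 4F refl) (step 4F 5F refl)
    (close 5F 0F refl refl)
    (distinct 0F 2F λ ()) (distinct 2F 4F λ ()) (distinct 4F 0F λ ())
    (distinct 1F 3F λ ()) (distinct 3F 5F λ ()) (distinct 5F 1F λ ())
    where
    open Cycle cy
    distinct : ∀ i j → i ≢ j → vert i ≢ vert j
    distinct i j i≢j = i≢j ∘ inj i j

  hexagon⇒cycle : Hexagon → Cycle Adj 6
  hexagon⇒cycle h = record
    { three≤ℓ = s≤s (s≤s (s≤s z≤n))
    ; vert    = lookup vertices
    ; inj     = lookup-injective vertices-unique
    ; step    = step
    ; close   = λ i j i≡5 j≡0 → subst₂ (λ i j → Adj (lookup vertices i) (lookup vertices j))
                  (sym (toℕ-injective {j = 5F} i≡5)) (sym (toℕ-injective {j = 0F} j≡0)) m₂₀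
    }
    where
    open Hexagon h
    vertices : Vec (C ⊎ R) 6
    vertices = inj₁ c₀ ∷ inj₂ r₀ ∷ inj₁ c₁ ∷ inj₂ r₁ ∷ inj₁ c₂ ∷ inj₂ r₂ ∷ []
    vertices-unique : Unique vertices
    vertices-unique =
        ((λ ()) ∷ c₀≢c₁ ∘ inj₁-injective ∷ (λ ()) ∷ c₂≢c₀ ∘ sym ∘ inj₁-injective ∷ (λ ()) ∷ [])
      ∷ ((λ ()) ∷ r₀≢r₁ ∘ inj₂-injective ∷ (λ ()) ∷ r₂≢r₀ ∘ sym ∘ inj₂-injective ∷ [])
      ∷ ((λ ()) ∷ c₁≢c₂ ∘ inj₁-injective ∷ (λ ()) ∷ [])
      ∷ ((λ ()) ∷ r₁≢r₂ ∘ inj₂-injective ∷ [])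
      ∷ ((λ ()) ∷ [])
      ∷ [] ∷ []
    step : ∀ i j → toℕ j ≡ suc (toℕ i) → Adj (lookup vertices i) (lookup vertices j)
    step 0F j j≡1 rewrite toℕ-injective {j = 1F} j≡1 = m₀₀
    step 1F j j≡2 rewrite toℕ-injective {j = 2F} j≡2 = m₀₁
    step 2F j j≡3 rewrite toℕ-injective {j = 3F} j≡3 = m₁₁
    step 3F j j≡4 rewrite toℕ-injective {j = 4F} j≡4 = m₁₂
    step 4F j j≡5 rewrite toℕ-injective {j = 5F} j≡5 = m₂₂
    step 5F j j≡6 = contradiction (subst (_< 6) j≡6 (toℕ<n j)) (n≮n 6)

  girth≥8 : ¬ Rectangle → ¬ Hexagon → GirthAtLeast Adj 8
  girth≥8 _    _    0 record { three≤ℓ = () }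
  girth≥8 _    _    1 record { three≤ℓ = s≤s () }
  girth≥8 _    _    2 record { three≤ℓ = s≤s (s≤s ()) }
  girth≥8 _    _    3 cy = contradiction cy (no-odd-cycle 1)
  girth≥8 no-R _    4 cy = contradiction (cycle⇒rectangle cy) no-R
  girth≥8 _    _    5 cy = contradiction cy (no-odd-cycle 2)
  girth≥8 _    no-H 6 cy = contradiction (cycle⇒hexagon cy) no-H
  girth≥8 _    _    7 cy = contradiction cy (no-odd-cycle 3)
  girth≥8 _    _    (suc (suc (suc (suc (suc (suc (suc (suc _)))))))) _ =
    s≤s (s≤s (s≤s (s≤s (s≤s (s≤s (s≤s (s≤s z≤n)))))))

  hexagon⇒¬girth≥8 : Hexagon → ¬ GirthAtLeast Adj 8
  hexagon⇒¬girth≥8 h girth with girth 6 (hexagon⇒cycle h)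
  ... | s≤s (s≤s (s≤s (s≤s (s≤s (s≤s ())))))

module CirculantBlocks {BR BC : Set} (q : ℕ) (E : BR → BC → ℤ) where

  CirculantMatrix : BR × Fin q → BC × Fin q → Set
  CirculantMatrix (i , u) (k , v) = + toℕ v ≡ + toℕ u + E i k [mod q ]

  open TannerCycles CirculantMatrix

  defect : BR × Fin q → BC × Fin q → ℤ
  defect (i , u) (k , v) = + toℕ v - (+ toℕ u + E i k)

  entry⇒∣ : ∀ {r c} → CirculantMatrix r c → + q ∣ℤ defect r c
  entry⇒∣ {r} {c} = ∣ᵤ⇒∣ {i = defect r c}

  ∣⇒entry : ∀ {r c} → + q ∣ℤ defect r c → CirculantMatrix r c
  ∣⇒entry = ∣⇒∣ᵤ

  entry-column-unique : ∀ {i u k v v′} → CirculantMatrix (i , u) (k , v) → CirculantMatrix (i , u) (k , v′) → v ≡ v′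
  entry-column-unique {i} {u} {k} {v} {v′} m m′ = toℕ-injective (≡[mod]⇒≡ (toℕ<n v) (toℕ<n v′) (∣⇒∣ᵤ
    (subst (+ q ∣ℤ_) (difference (+ toℕ v) (+ toℕ v′) (+ toℕ u + E i k)) (∣m∣n⇒∣m-n (entry⇒∣ m) (entry⇒∣ m′)))))
    where
    difference : ∀ v v′ w → (v - w) - (v′ - w) ≡ v - v′
    difference = solve-∀

  entry-row-unique : ∀ {i u u′ k v} → CirculantMatrix (i , u) (k , v) → CirculantMatrix (i , u′) (k , v) → u ≡ u′
  entry-row-unique {i} {u} {u′} {k} {v} m m′ = toℕ-injective (≡[mod]⇒≡ (toℕ<n u) (toℕ<n u′) (∣⇒∣ᵤ
    (subst (+ q ∣ℤ_) (difference (+ toℕ v) (+ toℕ u) (+ toℕ u′) (E i k)) (∣m∣n⇒∣m-n (entry⇒∣ m′) (entry⇒∣ m)))))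
    where
    difference : ∀ v u u′ e → (v - (u′ + e)) - (v - (u + e)) ≡ u - u′
    difference = solve-∀

  distinct-in-row⇒distinct-blocks : ∀ {i u k v k′ v′} →
    CirculantMatrix (i , u) (k , v) → CirculantMatrix (i , u) (k′ , v′) → (k , v) ≢ (k′ , v′) → k ≢ k′
  distinct-in-row⇒distinct-blocks m m′ c≢c′ refl = c≢c′ (cong (_ ,_) (entry-column-unique m m′))

  distinct-in-column⇒distinct-blocks : ∀ {i u i′ u′ k v} →
    CirculantMatrix (i , u) (k , v) → CirculantMatrix (i′ , u′) (k , v) → (i , u) ≢ (i′ , u′) → i ≢ i′
  distinct-in-column⇒distinct-blocks m m′ r≢r′ refl = r≢r′ (cong (_ ,_) (entry-row-unique m m′))

  record BlockRectangle : Set where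
    field
      i₀ i₁ : BR
      k₀ k₁ : BC
      i₀≢i₁ : i₀ ≢ i₁
      k₀≢k₁ : k₀ ≢ k₁
      balanced : + q ∣ℤ E i₀ k₀ - E i₀ k₁ + E i₁ k₁ - E i₁ k₀

  record BlockHexagon : Set where
    field
      i₀ i₁ i₂ : BR
      k₀ k₁ k₂ : BC
      i₀≢i₁ : i₀ ≢ i₁
      i₁≢i₂ : i₁ ≢ i₂
      i₂≢i₀ : i₂ ≢ i₀
      k₀≢k₁ : k₀ ≢ k₁
      k₁≢k₂ : k₁ ≢ k₂
      k₂≢k₀ : k₂ ≢ k₀
      balanced : + q ∣ℤ E i₀ k₀ - E i₀ k₁ + E i₁ k₁ - E i₁ k₂ + E i₂ k₂ - E i₂ k₀

  defects-telescope₄ : ∀ r₀ r₁ c₀ c₁ →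
    (defect r₀ c₁ - defect r₀ c₀) + (defect r₁ c₀ - defect r₁ c₁)
      ≡ E (proj₁ r₀) (proj₁ c₀) - E (proj₁ r₀) (proj₁ c₁) + E (proj₁ r₁) (proj₁ c₁) - E (proj₁ r₁) (proj₁ c₀)
  defects-telescope₄ (i₀ , u₀) (i₁ , u₁) (k₀ , v₀) (k₁ , v₁) =
    identity (+ toℕ v₀) (+ toℕ v₁) (+ toℕ u₀) (+ toℕ u₁) (E i₀ k₀) (E i₀ k₁) (E i₁ k₁) (E i₁ k₀)
    where
    identity : ∀ v₀ v₁ u₀ u₁ e₀₀ e₀₁ e₁₁ e₁₀ →
      (v₁ - (u₀ + e₀₁)) - (v₀ - (u₀ + e₀₀)) + ((v₀ - (u₁ + e₁₀)) - (v₁ - (u₁ + e₁₁))) ≡ e₀₀ - e₀₁ + e₁₁ - e₁₀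
    identity = solve-∀

  rectangle⇒blockRectangle : Rectangle → BlockRectangle
  rectangle⇒blockRectangle ρ = record
    { i₀ = proj₁ r₀ ; i₁ = proj₁ r₁ ; k₀ = proj₁ c₀ ; k₁ = proj₁ c₁
    ; i₀≢i₁ = distinct-in-column⇒distinct-blocks m₀₀ m₁₀ r₀≢r₁
    ; k₀≢k₁ = distinct-in-row⇒distinct-blocks m₀₀ m₀₁ c₀≢c₁
    ; balanced = subst (+ q ∣ℤ_) (defects-telescope₄ r₀ r₁ c₀ c₁)
        (∣m∣n⇒∣m+n (∣m∣n⇒∣m-n (entry⇒∣ m₀₁) (entry⇒∣ m₀₀)) (∣m∣n⇒∣m-n (entry⇒∣ m₁₀) (entry⇒∣ m₁₁)))
    }
    where open Rectangle ρ

  defects-telescope₆ : ∀ r₀ r₁ r₂ c₀ c₁ c₂ →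
    (defect r₀ c₁ - defect r₀ c₀) + (defect r₁ c₂ - defect r₁ c₁) + (defect r₂ c₀ - defect r₂ c₂)
      ≡ E (proj₁ r₀) (proj₁ c₀) - E (proj₁ r₀) (proj₁ c₁) + E (proj₁ r₁) (proj₁ c₁)
        - E (proj₁ r₁) (proj₁ c₂) + E (proj₁ r₂) (proj₁ c₂) - E (proj₁ r₂) (proj₁ c₀)
  defects-telescope₆ (i₀ , u₀) (i₁ , u₁) (i₂ , u₂) (k₀ , v₀) (k₁ , v₁) (k₂ , v₂) =
    identity (+ toℕ v₀) (+ toℕ v₁) (+ toℕ v₂) (+ toℕ u₀) (+ toℕ u₁) (+ toℕ u₂)
             (E i₀ k₀) (E i₀ k₁) (E i₁ k₁) (E i₁ k₂) (E i₂ k₂) (E i₂ k₀)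
    where
    identity : ∀ v₀ v₁ v₂ u₀ u₁ u₂ e₀₀ e₀₁ e₁₁ e₁₂ e₂₂ e₂₀ →
      (v₁ - (u₀ + e₀₁)) - (v₀ - (u₀ + e₀₀)) + ((v₂ - (u₁ + e₁₂)) - (v₁ - (u₁ + e₁₁)))
        + ((v₀ - (u₂ + e₂₀)) - (v₂ - (u₂ + e₂₂)))
      ≡ e₀₀ - e₀₁ + e₁₁ - e₁₂ + e₂₂ - e₂₀
    identity = solve-∀

  hexagon⇒blockHexagon : Hexagon → BlockHexagon
  hexagon⇒blockHexagon η = record
    { i₀ = proj₁ r₀ ; i₁ = proj₁ r₁ ; i₂ = proj₁ r₂ ; k₀ = proj₁ c₀ ; k₁ = proj₁ c₁ ; k₂ = proj₁ c₂
    ; i₀≢i₁ = distinct-in-column⇒distinct-blocks m₀₁ m₁₁ r₀≢r₁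
    ; i₁≢i₂ = distinct-in-column⇒distinct-blocks m₁₂ m₂₂ r₁≢r₂
    ; i₂≢i₀ = distinct-in-column⇒distinct-blocks m₂₀ m₀₀ r₂≢r₀
    ; k₀≢k₁ = distinct-in-row⇒distinct-blocks m₀₀ m₀₁ c₀≢c₁
    ; k₁≢k₂ = distinct-in-row⇒distinct-blocks m₁₁ m₁₂ c₁≢c₂
    ; k₂≢k₀ = distinct-in-row⇒distinct-blocks m₂₂ m₂₀ c₂≢c₀
    ; balanced = subst (+ q ∣ℤ_) (defects-telescope₆ r₀ r₁ r₂ c₀ c₁ c₂)
        (∣m∣n⇒∣m+n (∣m∣n⇒∣m+n (∣m∣n⇒∣m-n (entry⇒∣ m₀₁) (entry⇒∣ m₀₀)) (∣m∣n⇒∣m-n (entry⇒∣ m₁₂) (entry⇒∣ m₁₁)))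
                   (∣m∣n⇒∣m-n (entry⇒∣ m₂₀) (entry⇒∣ m₂₂)))
    }
    where open Hexagon η

  module _ .{{_ : NonZero q}} where

    residue : ℤ → Fin q
    residue z = fromℕ< (n%ℕd<d z q)

    residue-congruent : ∀ z → + q ∣ℤ (+ toℕ (residue z) - z)
    residue-congruent z rewrite toℕ-fromℕ< (n%ℕd<d z q) =
      subst (+ q ∣ℤ_)
        (trans (identity (+ (z %ℕ q)) (z /ℕ q) (+ q)) (cong (_-_ (+ (z %ℕ q))) (sym (a≡a%ℕn+[a/ℕn]*n z q))))
        (∣n⇒∣m*n (- (z /ℕ q)) ∣-refl)
      where
      identity : ∀ r k n → - k * n ≡ r - (r + k * n)
      identity = solve-∀

    column-entry : ∀ i u k → CirculantMatrix (i , u) (k , residue (+ toℕ u + E i k))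
    column-entry i u k = ∣⇒entry (residue-congruent (+ toℕ u + E i k))

    row-entry : ∀ i k v → CirculantMatrix (i , residue (+ toℕ v - E i k)) (k , v)
    row-entry i k v = ∣⇒entry (subst (+ q ∣ℤ_) (flip (+ toℕ v) (+ toℕ (residue (+ toℕ v - E i k))) (E i k))
      (∣m⇒∣-m (residue-congruent (+ toℕ v - E i k))))
      where
      flip : ∀ v u e → - (u - (v - e)) ≡ v - (u + e)
      flip = solve-∀

    -- Walk around the hexagon letting the permutation blocks pick each next vertex; the balance
    -- condition makes the last step return to the start.
    blockHexagon⇒hexagon : BlockHexagon → Hexagon
    blockHexagon⇒hexagon β = record
      { c₀ = k₀ , v₀ ; c₁ = k₁ , v₁ ; c₂ = k₂ , v₂ ; r₀ = i₀ , u₀ ; r₁ = i₁ , u₁ ; r₂ = i₂ , u₂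
      ; c₀≢c₁ = k₀≢k₁ ∘ cong proj₁ ; c₁≢c₂ = k₁≢k₂ ∘ cong proj₁ ; c₂≢c₀ = k₂≢k₀ ∘ cong proj₁
      ; r₀≢r₁ = i₀≢i₁ ∘ cong proj₁ ; r₁≢r₂ = i₁≢i₂ ∘ cong proj₁ ; r₂≢r₀ = i₂≢i₀ ∘ cong proj₁
      ; m₀₀ = m₀₀ ; m₀₁ = m₀₁ ; m₁₁ = m₁₁ ; m₁₂ = m₁₂ ; m₂₂ = m₂₂ ; m₂₀ = m₂₀
      }
      where
      open BlockHexagon β
      u₀ v₀ v₁ u₁ v₂ u₂ : Fin q
      u₀ = residue (+ 0)
      v₀ = residue (+ toℕ u₀ + E i₀ k₀)
      v₁ = residue (+ toℕ u₀ + E i₀ k₁)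
      u₁ = residue (+ toℕ v₁ - E i₁ k₁)
      v₂ = residue (+ toℕ u₁ + E i₁ k₂)
      u₂ = residue (+ toℕ v₂ - E i₂ k₂)
      m₀₀ = column-entry i₀ u₀ k₀
      m₀₁ = column-entry i₀ u₀ k₁
      m₁₁ = row-entry i₁ k₁ v₁
      m₁₂ = column-entry i₁ u₁ k₂
      m₂₂ = row-entry i₂ k₂ v₂
      m₂₀ : CirculantMatrix (i₂ , u₂) (k₀ , v₀)
      m₂₀ = ∣⇒entry (∣m+n∣n⇒∣m (∣m+n∣m⇒∣n
        (subst (+ q ∣ℤ_) (sym (defects-telescope₆ (i₀ , u₀) (i₁ , u₁) (i₂ , u₂) (k₀ , v₀) (k₁ , v₁) (k₂ , v₂)))
               balanced)
        (∣m∣n⇒∣m+n (∣m∣n⇒∣m-n (entry⇒∣ m₀₁) (entry⇒∣ m₀₀)) (∣m∣n⇒∣m-n (entry⇒∣ m₁₂) (entry⇒∣ m₁₁))))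
        (∣m⇒∣-m (entry⇒∣ m₂₂)))

-- Opaque, so that the implicit arguments of lemmas about it are found by unification.
opaque
  cyclicForm : ℤ → ℤ → ℤ → ℤ → ℤ → ℤ → ℤ
  cyclicForm t₀ t₁ t₂ x₀ x₁ x₂ = x₀ * (t₀ - t₂) + x₁ * (t₁ - t₀) + x₂ * (t₂ - t₁)

opaque
  unfolding cyclicForm

  cyclicForm-rotate : ∀ t₀ t₁ t₂ x₀ x₁ x₂ → cyclicForm t₀ t₁ t₂ x₀ x₁ x₂ ≡ cyclicForm t₁ t₂ t₀ x₁ x₂ x₀
  cyclicForm-rotate = identity
    where
    identity : ∀ t₀ t₁ t₂ x₀ x₁ x₂ →
      x₀ * (t₀ - t₂) + x₁ * (t₁ - t₀) + x₂ * (t₂ - t₁) ≡ x₁ * (t₁ - t₀) + x₂ * (t₂ - t₁) + x₀ * (t₀ - t₂)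
    identity = solve-∀

  cyclicForm-reflect : ∀ t₀ t₁ t₂ x₀ x₁ x₂ → cyclicForm t₀ t₂ t₁ x₁ x₀ x₂ ≡ - cyclicForm t₀ t₁ t₂ x₀ x₁ x₂
  cyclicForm-reflect = identity
    where
    identity : ∀ t₀ t₁ t₂ x₀ x₁ x₂ →
      x₁ * (t₀ - t₁) + x₀ * (t₂ - t₀) + x₂ * (t₁ - t₂) ≡ - (x₀ * (t₀ - t₂) + x₁ * (t₁ - t₀) + x₂ * (t₂ - t₁))
    identity = solve-∀

  cyclicForm-gaps : ∀ t a b x₀ x₁ x₂ →
    cyclicForm t (+ 1 + t + a) (+ 1 + (+ 1 + t + a) + b) x₀ x₁ x₂
      ≡ (x₁ * (+ 1 + a) + x₂ * (+ 1 + b)) - x₀ * ((+ 1 + a) + (+ 1 + b))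
  cyclicForm-gaps = identity
    where
    identity : ∀ t a b x₀ x₁ x₂ →
      x₀ * (t - (+ 1 + (+ 1 + t + a) + b)) + x₁ * ((+ 1 + t + a) - t) + x₂ * ((+ 1 + (+ 1 + t + a) + b) - (+ 1 + t + a))
        ≡ (x₁ * (+ 1 + a) + x₂ * (+ 1 + b)) - x₀ * ((+ 1 + a) + (+ 1 + b))
    identity = solve-∀

  cyclicForm-averaging : ∀ c x₀ x₁ x₂ → cyclicForm (+ 1) (+ 1 + c) (+ 0) x₀ x₁ x₂ ≡ (x₀ + c * x₁) - (+ 1 + c) * x₂
  cyclicForm-averaging = identity
    where
    identity : ∀ c x₀ x₁ x₂ →
      x₀ * (+ 1 - + 0) + x₁ * ((+ 1 + c) - + 1) + x₂ * (+ 0 - (+ 1 + c)) ≡ (x₀ + c * x₁) - (+ 1 + c) * x₂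
    identity = solve-∀

  alternatingSum-affine : ∀ a₀ d s t₀ t₁ t₂ x₀ x₁ x₂ →
    (a₀ + t₀ * d) * x₀ * s - (a₀ + t₀ * d) * x₁ * s + (a₀ + t₁ * d) * x₁ * s
      - (a₀ + t₁ * d) * x₂ * s + (a₀ + t₂ * d) * x₂ * s - (a₀ + t₂ * d) * x₀ * s
    ≡ (s * d) * cyclicForm t₀ t₁ t₂ x₀ x₁ x₂
  alternatingSum-affine = identity
    where
    identity : ∀ a₀ d s t₀ t₁ t₂ x₀ x₁ x₂ →
      (a₀ + t₀ * d) * x₀ * s - (a₀ + t₀ * d) * x₁ * s + (a₀ + t₁ * d) * x₁ * s
        - (a₀ + t₁ * d) * x₂ * s + (a₀ + t₂ * d) * x₂ * s - (a₀ + t₂ * d) * x₀ * s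
      ≡ (s * d) * (x₀ * (t₀ - t₂) + x₁ * (t₁ - t₀) + x₂ * (t₂ - t₁))
    identity = solve-∀

weighted-1c : ∀ c x₀ x₁ x₂ → (x₁ * + 1 + x₂ * c) - x₀ * (+ 1 + c) ≡ (x₁ + c * x₂) - (+ 1 + c) * x₀
weighted-1c = solve-∀

weighted-c1 : ∀ c x₀ x₁ x₂ → (x₁ * c + x₂ * + 1) - x₀ * (c + + 1) ≡ (x₂ + c * x₁) - (+ 1 + c) * x₀
weighted-c1 = solve-∀

∣-rotate : ∀ {q t₀ t₁ t₂ x₀ x₁ x₂} → q ∣ℤ cyclicForm t₀ t₁ t₂ x₀ x₁ x₂ → q ∣ℤ cyclicForm t₁ t₂ t₀ x₁ x₂ x₀
∣-rotate {q} {t₀} {t₁} {t₂} {x₀} {x₁} {x₂} = subst (q ∣ℤ_) (cyclicForm-rotate t₀ t₁ t₂ x₀ x₁ x₂)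

∣-reflect : ∀ {q t₀ t₁ t₂ x₀ x₁ x₂} → q ∣ℤ cyclicForm t₀ t₁ t₂ x₀ x₁ x₂ → q ∣ℤ cyclicForm t₀ t₂ t₁ x₁ x₀ x₂
∣-reflect {q} {t₀} {t₁} {t₂} {x₀} {x₁} {x₂} = subst (q ∣ℤ_) (sym (cyclicForm-reflect t₀ t₁ t₂ x₀ x₁ x₂)) ∘ ∣m⇒∣-m

minimum-of-three : ∀ {t₀ t₁ t₂} → t₀ ≢ t₁ → t₁ ≢ t₂ → t₂ ≢ t₀ →
  (t₀ < t₁ × t₀ < t₂) ⊎ (t₁ < t₂ × t₁ < t₀) ⊎ (t₂ < t₀ × t₂ < t₁)
minimum-of-three {t₀} {t₁} {t₂} t₀≢t₁ t₁≢t₂ t₂≢t₀ with <-cmp t₀ t₁ | <-cmp t₁ t₂ | <-cmp t₂ t₀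
... | tri≈ _ t₀≡t₁ _ | _              | _              = contradiction t₀≡t₁ t₀≢t₁
... | _              | tri≈ _ t₁≡t₂ _ | _              = contradiction t₁≡t₂ t₁≢t₂
... | _              | _              | tri≈ _ t₂≡t₀ _ = contradiction t₂≡t₀ t₂≢t₀
... | tri< t₀<t₁ _ _ | _              | tri> _ _ t₀<t₂ = inj₁ (t₀<t₁ , t₀<t₂)
... | tri> _ _ t₁<t₀ | tri< t₁<t₂ _ _ | _              = inj₂ (inj₁ (t₁<t₂ , t₁<t₀))
... | _              | tri> _ _ t₂<t₁ | tri< t₂<t₀ _ _ = inj₂ (inj₂ (t₂<t₀ , t₂<t₁))
... | tri< t₀<t₁ _ _ | tri< t₁<t₂ _ _ | tri< t₂<t₀ _ _ = contradiction (<-trans (<-trans t₀<t₁ t₁<t₂) t₂<t₀) (n≮n t₀)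
... | tri> _ _ t₁<t₀ | tri> _ _ t₂<t₁ | tri> _ _ t₀<t₂ = contradiction (<-trans (<-trans t₀<t₂ t₂<t₁) t₁<t₀) (n≮n t₀)

module AveragingRelations {q : ℕ} (isPrime : Prime q) {m : ℕ} (n : Fin m → ℕ)
                 (n<q : ∀ k → n k < q) (n-injective : ∀ {k k′} → n k ≡ n k′ → k ≡ k′) where

  x : Fin m → ℤ
  x k = + n k

  Averaging : ℕ → Fin m → Fin m → Fin m → Set
  Averaging c i j k = (+ n i) + (+ c) * (+ n j) ≡ (+ suc c) * (+ n k) [mod q ]

  congruent⇒≡ : ∀ {k k′} → + q ∣ℤ x k - x k′ → k ≡ k′
  congruent⇒≡ q∣x-x′ = n-injective (≡[mod]⇒≡ (n<q _) (n<q _) (∣⇒∣ᵤ q∣x-x′))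

  repeated-index⇒trivial : ∀ {c i j k} → ¬ q ∣ c → ¬ q ∣ suc c → i ≡ j ⊎ j ≡ k ⊎ k ≡ i →
                           Averaging c i j k → i ≡ j × j ≡ k
  repeated-index⇒trivial {c} {i} {k = k} _ q∤1+c (inj₁ refl) avg
    with prime-∣-* isPrime (+ suc c) (x i - x k) (subst (+ q ∣ℤ_) (identity (+ c) (x i) (x k)) (∣ᵤ⇒∣ avg))
    where
    identity : ∀ c y z → (y + c * y) - (+ 1 + c) * z ≡ (+ 1 + c) * (y - z)
    identity = solve-∀
  ... | inj₁ q∣1+c = contradiction (∣⇒∣ᵤ q∣1+c) q∤1+c
  ... | inj₂ q∣xi-xk = refl , congruent⇒≡ q∣xi-xk
  repeated-index⇒trivial {c} {i} {j} _ _ (inj₂ (inj₁ refl)) avg =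
    congruent⇒≡ (subst (+ q ∣ℤ_) (identity (+ c) (x i) (x j)) (∣ᵤ⇒∣ avg)) , refl
    where
    identity : ∀ c y z → (y + c * z) - (+ 1 + c) * z ≡ y - z
    identity = solve-∀
  repeated-index⇒trivial {c} {i} {j} q∤c _ (inj₂ (inj₂ refl)) avg
    with prime-∣-* isPrime (+ c) (x j - x i) (subst (+ q ∣ℤ_) (identity (+ c) (x i) (x j)) (∣ᵤ⇒∣ avg))
    where
    identity : ∀ c y z → (y + c * z) - (+ 1 + c) * y ≡ c * (z - y)
    identity = solve-∀
  ... | inj₁ q∣c = contradiction (∣⇒∣ᵤ q∣c) q∤c
  ... | inj₂ q∣xj-xi = sym (congruent⇒≡ q∣xj-xi) , congruent⇒≡ q∣xj-xi

  nonAveraging-from-distinct : ∀ {c} → ¬ q ∣ c → ¬ q ∣ suc c →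
    (∀ {i j k} → i ≢ j → j ≢ k → k ≢ i → ¬ Averaging c i j k) → NonAveraging[ c ] q n
  nonAveraging-from-distinct q∤c q∤1+c no-distinct i j k avg with i ≟ j | j ≟ k | k ≟ i
  ... | yes i≡j | _       | _       = repeated-index⇒trivial q∤c q∤1+c (inj₁ i≡j) avg
  ... | no _    | yes j≡k | _       = repeated-index⇒trivial q∤c q∤1+c (inj₂ (inj₁ j≡k)) avg
  ... | no _    | no _    | yes k≡i = repeated-index⇒trivial q∤c q∤1+c (inj₂ (inj₂ k≡i)) avg
  ... | no i≢j  | no j≢k  | no k≢i  = contradiction avg (no-distinct i≢j j≢k k≢i)

  averaging⇒cyclicForm : ∀ {c i j k} → Averaging c i j k → + q ∣ℤ cyclicForm (+ 1) (+ suc c) (+ 0) (x i) (x j) (x k)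
  averaging⇒cyclicForm {c} {i} {j} {k} avg =
    subst (+ q ∣ℤ_) (sym (cyclicForm-averaging (+ c) (x i) (x j) (x k))) (∣ᵤ⇒∣ avg)

  module _ (na₁ : NonAveraging[ 1 ] q n) (na₂ : NonAveraging[ 2 ] q n) where

    increasing⇒cyclicForm-nonzero : ∀ {t₀ t₁ t₂ k₀ k₁ k₂} → t₀ < t₁ → t₁ < t₂ → t₂ ≤ 3 → k₁ ≢ k₂ →
      ¬ + q ∣ℤ cyclicForm (+ t₀) (+ t₁) (+ t₂) (x k₀) (x k₁) (x k₂)
    increasing⇒cyclicForm-nonzero {t₀} {k₀ = k₀} {k₁} {k₂} t₀<t₁ t₁<t₂ t₂≤3 k₁≢k₂ q∣form
      with m≤n⇒∃[o]m+o≡n t₀<t₁ | m≤n⇒∃[o]m+o≡n t₁<t₂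
    ... | a , refl | b , refl =
      by-gaps a b (gaps≤1 t₂≤3) (subst (+ q ∣ℤ_) (cyclicForm-gaps (+ t₀) (+ a) (+ b) (x k₀) (x k₁) (x k₂)) q∣form)
      where
      gaps≤1 : suc (suc t₀ ℕ.+ a) ℕ.+ b ≤ 3 → a ℕ.+ b ≤ 1
      gaps≤1 (s≤s (s≤s t₀+a+b≤1)) = ≤-trans (m≤n+m (a ℕ.+ b) t₀) (subst (_≤ 1) (+-assoc t₀ a b) t₀+a+b≤1)
      by-gaps : ∀ a b → a ℕ.+ b ≤ 1 →
        ¬ + q ∣ℤ (x k₁ * (+ 1 + + a) + x k₂ * (+ 1 + + b)) - x k₀ * ((+ 1 + + a) + (+ 1 + + b))
      by-gaps 0 0 _ h = k₁≢k₂ (proj₁ (na₁ k₁ k₂ k₀ (∣⇒∣ᵤ (subst (+ q ∣ℤ_) (weighted-1c (+ 1) (x k₀) (x k₁) (x k₂)) h))))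
      by-gaps 0 1 _ h = k₁≢k₂ (proj₁ (na₂ k₁ k₂ k₀ (∣⇒∣ᵤ (subst (+ q ∣ℤ_) (weighted-1c (+ 2) (x k₀) (x k₁) (x k₂)) h))))
      by-gaps 1 0 _ h =
        k₁≢k₂ (sym (proj₁ (na₂ k₂ k₁ k₀ (∣⇒∣ᵤ (subst (+ q ∣ℤ_) (weighted-c1 (+ 2) (x k₀) (x k₁) (x k₂)) h)))))
      by-gaps 0 (suc (suc _)) (s≤s ())
      by-gaps 1 (suc _) (s≤s ())
      by-gaps (suc (suc _)) _ (s≤s ())

    minimum-first⇒cyclicForm-nonzero : ∀ {t₀ t₁ t₂ k₀ k₁ k₂} → t₀ < t₁ → t₀ < t₂ → t₁ ≢ t₂ → t₁ ≤ 3 → t₂ ≤ 3 →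
      k₁ ≢ k₂ → k₂ ≢ k₀ → ¬ + q ∣ℤ cyclicForm (+ t₀) (+ t₁) (+ t₂) (x k₀) (x k₁) (x k₂)
    minimum-first⇒cyclicForm-nonzero {t₁ = t₁} {t₂} t₀<t₁ t₀<t₂ t₁≢t₂ t₁≤3 t₂≤3 k₁≢k₂ k₂≢k₀ q∣form
      with <-cmp t₁ t₂
    ... | tri< t₁<t₂ _ _ = increasing⇒cyclicForm-nonzero t₀<t₁ t₁<t₂ t₂≤3 k₁≢k₂ q∣form
    ... | tri≈ _ t₁≡t₂ _ = t₁≢t₂ t₁≡t₂
    ... | tri> _ _ t₂<t₁ = increasing⇒cyclicForm-nonzero t₀<t₂ t₂<t₁ t₁≤3 (k₂≢k₀ ∘ sym) (∣-reflect q∣form)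

    cyclicForm-nonzero : ∀ {t₀ t₁ t₂ k₀ k₁ k₂} → t₀ ≢ t₁ → t₁ ≢ t₂ → t₂ ≢ t₀ → t₀ ≤ 3 → t₁ ≤ 3 → t₂ ≤ 3 →
      k₀ ≢ k₁ → k₁ ≢ k₂ → k₂ ≢ k₀ → ¬ + q ∣ℤ cyclicForm (+ t₀) (+ t₁) (+ t₂) (x k₀) (x k₁) (x k₂)
    cyclicForm-nonzero t₀≢t₁ t₁≢t₂ t₂≢t₀ t₀≤3 t₁≤3 t₂≤3 k₀≢k₁ k₁≢k₂ k₂≢k₀ q∣form
      with minimum-of-three t₀≢t₁ t₁≢t₂ t₂≢t₀
    ... | inj₁ (t₀<t₁ , t₀<t₂) =
      minimum-first⇒cyclicForm-nonzero t₀<t₁ t₀<t₂ t₁≢t₂ t₁≤3 t₂≤3 k₁≢k₂ k₂≢k₀ q∣form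
    ... | inj₂ (inj₁ (t₁<t₂ , t₁<t₀)) =
      minimum-first⇒cyclicForm-nonzero t₁<t₂ t₁<t₀ t₂≢t₀ t₂≤3 t₀≤3 k₂≢k₀ k₀≢k₁ (∣-rotate q∣form)
    ... | inj₂ (inj₂ (t₂<t₀ , t₂<t₁)) =
      minimum-first⇒cyclicForm-nonzero t₂<t₀ t₂<t₁ t₀≢t₁ t₀≤3 t₁≤3 k₀≢k₁ k₁≢k₂ (∣-rotate (∣-rotate q∣form))

strictlyIncreasing⇒injective : ∀ {m q} {L : Fin m → Fin q} → StrictlyIncreasing L →
                               ∀ {k k′} → toℕ (L k) ≡ toℕ (L k′) → k ≡ k′
strictlyIncreasing⇒injective increasing {k} {k′} Lk≡Lk′ with <-cmp (toℕ k) (toℕ k′)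
... | tri< k<k′ _ _ = contradiction (increasing k k′ k<k′) (<-irrefl Lk≡Lk′)
... | tri≈ _ k≡k′ _ = toℕ-injective k≡k′
... | tri> _ _ k′<k = contradiction (increasing k′ k k′<k) (<-irrefl (sym Lk≡Lk′))

properAP-injective : ∀ {a} → ProperAP a → ∀ {i j} → a i ≡ a j → i ≡ j
properAP-injective {a} (d , d≢0 , affine) {i} {j} aᵢ≡aⱼ =
  toℕ-injective (+-injective (*-cancelʳ-≡ (+ toℕ i) (+ toℕ j) d {{≢-nonZero d≢0}} (begin
    + toℕ i * d                      ≡⟨ offset (+ a 0F) (+ toℕ i * d) ⟩
    (+ a 0F + + toℕ i * d) - + a 0F  ≡⟨ cong (_- + a 0F) (sym (affine i)) ⟩
    + a i - + a 0F                   ≡⟨ cong (λ aᵢ → + aᵢ - + a 0F) aᵢ≡aⱼ ⟩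
    + a j - + a 0F                   ≡⟨ cong (_- + a 0F) (affine j) ⟩
    (+ a 0F + + toℕ j * d) - + a 0F  ≡⟨ sym (offset (+ a 0F) (+ toℕ j * d)) ⟩
    + toℕ j * d                      ∎)))
  where
  open ≡-Reasoning
  offset : ∀ y z → z ≡ (y + z) - y
  offset = solve-∀

module ProperArrayCode {q : ℕ} (isPrime : Prime q) {s : ℕ} (1≤s : 1 ≤ s) (s<q : s < q)
                       {a : Fin 4 → ℕ} (a<q : ∀ i → a i < q) (ap : ProperAP a)
                       {m : ℕ} {L : Fin m → Fin q} (L-increasing : StrictlyIncreasing L) where

  instance
    q≢0 : NonZero q
    q≢0 = prime⇒nonZero isPrime

  d : ℤ
  d = proj₁ ap

  a-affine : ∀ i → + a i ≡ + a 0F + + toℕ i * d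
  a-affine = proj₂ (proj₂ ap)

  ℓ : Fin m → ℤ
  ℓ k = + toℕ (L k)

  -- With these exponents CirculantMatrix q E is ShortenedArray q s a L, definitionally.
  E : Fin 4 → Fin m → ℤ
  E i k = + (a i ℕ.* toℕ (L k) ℕ.* s)

  open CirculantBlocks q E
  open TannerCycles CirculantMatrix
  open AveragingRelations isPrime (toℕ ∘ L) (toℕ<n ∘ L) (strictlyIncreasing⇒injective L-increasing)

  rows-congruent⇒≡ : ∀ {i j} → + q ∣ℤ + a i - + a j → i ≡ j
  rows-congruent⇒≡ {i} {j} q∣Δa = properAP-injective ap (≡[mod]⇒≡ (a<q i) (a<q j) (∣⇒∣ᵤ q∣Δa))

  3<q : 3 < q
  3<q = injective⇒≤ {f = λ i → fromℕ< (a<q i)}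
    (λ {i} {j} eq → properAP-injective ap
      (trans (sym (toℕ-fromℕ< (a<q i))) (trans (cong toℕ eq) (toℕ-fromℕ< (a<q j)))))

  q∤≤3 : ∀ c .{{_ : NonZero c}} → c ≤ 3 → ¬ q ∣ c
  q∤≤3 c c≤3 = >⇒∤ (≤-<-trans c≤3 3<q)

  q∤s : ¬ + q ∣ℤ + s
  q∤s q∣s = >⇒∤ {{>-nonZero 1≤s}} s<q (∣⇒∣ᵤ q∣s)

  q∤d : ¬ + q ∣ℤ d
  q∤d q∣d = contradiction (rows-congruent⇒≡ {1F} {0F} (subst (+ q ∣ℤ_) d≡a₁-a₀ q∣d)) λ ()
    where
    offset : ∀ a₀ d → d ≡ (a₀ + + 1 * d) - a₀
    offset = solve-∀
    d≡a₁-a₀ : d ≡ + a 1F - + a 0F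
    d≡a₁-a₀ = trans (offset (+ a 0F) d) (cong (_- + a 0F) (sym (a-affine 1F)))

  E-bilinear : ∀ i k → E i k ≡ + a i * ℓ k * + s
  E-bilinear i k = trans (pos-* (a i ℕ.* toℕ (L k)) s) (cong (_* + s) (pos-* (a i) (toℕ (L k))))

  E-affine : ∀ i k → E i k ≡ (+ a 0F + + toℕ i * d) * ℓ k * + s
  E-affine i k = trans (E-bilinear i k) (cong (λ aᵢ → aᵢ * ℓ k * + s) (a-affine i))

  rectangle-sum : ∀ i₀ i₁ k₀ k₁ → E i₀ k₀ - E i₀ k₁ + E i₁ k₁ - E i₁ k₀ ≡ + s * ((+ a i₀ - + a i₁) * (ℓ k₀ - ℓ k₁))
  rectangle-sum i₀ i₁ k₀ k₁
    rewrite E-bilinear i₀ k₀ | E-bilinear i₀ k₁ | E-bilinear i₁ k₁ | E-bilinear i₁ k₀ =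
      identity (+ a i₀) (+ a i₁) (ℓ k₀) (ℓ k₁) (+ s)
    where
    identity : ∀ α₀ α₁ x₀ x₁ s → α₀ * x₀ * s - α₀ * x₁ * s + α₁ * x₁ * s - α₁ * x₀ * s ≡ s * ((α₀ - α₁) * (x₀ - x₁))
    identity = solve-∀

  hexagon-sum : ∀ i₀ i₁ i₂ k₀ k₁ k₂ →
    E i₀ k₀ - E i₀ k₁ + E i₁ k₁ - E i₁ k₂ + E i₂ k₂ - E i₂ k₀
      ≡ (+ s * d) * cyclicForm (+ toℕ i₀) (+ toℕ i₁) (+ toℕ i₂) (ℓ k₀) (ℓ k₁) (ℓ k₂)
  hexagon-sum i₀ i₁ i₂ k₀ k₁ k₂
    rewrite E-affine i₀ k₀ | E-affine i₀ k₁ | E-affine i₁ k₁ | E-affine i₁ k₂ | E-affine i₂ k₂ | E-affine i₂ k₀ =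
      alternatingSum-affine (+ a 0F) d (+ s) (+ toℕ i₀) (+ toℕ i₁) (+ toℕ i₂) (ℓ k₀) (ℓ k₁) (ℓ k₂)

  no-blockRectangle : ¬ BlockRectangle
  no-blockRectangle β = prime-∤-* isPrime q∤s (prime-∤-* isPrime (i₀≢i₁ ∘ rows-congruent⇒≡) (k₀≢k₁ ∘ congruent⇒≡))
    (subst (+ q ∣ℤ_) (rectangle-sum i₀ i₁ k₀ k₁) balanced)
    where open BlockRectangle β

  toℕ≤3 : (i : Fin 4) → toℕ i ≤ 3
  toℕ≤3 i = ℕ.s≤s⁻¹ (toℕ<n i)

  nonAveraging⇒no-blockHexagon : NonAveraging[ 1 ] q (toℕ ∘ L) → NonAveraging[ 2 ] q (toℕ ∘ L) → ¬ BlockHexagon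
  nonAveraging⇒no-blockHexagon na₁ na₂ β = prime-∤-* isPrime (prime-∤-* isPrime q∤s q∤d)
    (cyclicForm-nonzero na₁ na₂ (i₀≢i₁ ∘ toℕ-injective) (i₁≢i₂ ∘ toℕ-injective) (i₂≢i₀ ∘ toℕ-injective)
       (toℕ≤3 i₀) (toℕ≤3 i₁) (toℕ≤3 i₂) k₀≢k₁ k₁≢k₂ k₂≢k₀)
    (subst (+ q ∣ℤ_) (hexagon-sum i₀ i₁ i₂ k₀ k₁ k₂) balanced)
    where open BlockHexagon β

  averaging⇒blockHexagon : ∀ {c i j k} (r : Fin 4) → toℕ r ≡ suc c → 1F ≢ r → r ≢ 0F →
                           i ≢ j → j ≢ k → k ≢ i → Averaging c i j k → BlockHexagon
  averaging⇒blockHexagon {c} {i} {j} {k} r r≡1+c 1≢r r≢0 i≢j j≢k k≢i avg = record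
    { i₀≢i₁ = 1≢r ; i₁≢i₂ = r≢0 ; i₂≢i₀ = λ ()
    ; k₀≢k₁ = i≢j ; k₁≢k₂ = j≢k ; k₂≢k₀ = k≢i
    ; balanced = subst (+ q ∣ℤ_) (sym (hexagon-sum 1F r 0F i j k))
        (∣n⇒∣m*n (+ s * d) (subst (λ t → + q ∣ℤ cyclicForm (+ 1) (+ t) (+ 0) (ℓ i) (ℓ j) (ℓ k)) (sym r≡1+c)
          (averaging⇒cyclicForm avg)))
    }

  girth⇒nonAveraging : GirthAtLeast Adj 8 → ∀ c (r : Fin 4) → toℕ r ≡ suc c → 1F ≢ r → r ≢ 0F →
                       ¬ q ∣ c → ¬ q ∣ suc c → NonAveraging[ c ] q (toℕ ∘ L)
  girth⇒nonAveraging girth c r r≡1+c 1≢r r≢0 q∤c q∤1+c = nonAveraging-from-distinct q∤c q∤1+c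
    λ i≢j j≢k k≢i avg → hexagon⇒¬girth≥8
      (blockHexagon⇒hexagon (averaging⇒blockHexagon r r≡1+c 1≢r r≢0 i≢j j≢k k≢i avg)) girth

  girth≥8⇔nonAveraging : GirthAtLeast Adj 8 ⇔ (NonAveraging q (toℕ ∘ L) × NonAveraging[ 2 ] q (toℕ ∘ L))
  girth≥8⇔nonAveraging = mk⇔
    (λ girth → girth⇒nonAveraging girth 1 2F refl (λ ()) (λ ()) (q∤≤3 1 (s≤s z≤n)) (q∤≤3 2 (s≤s (s≤s z≤n)))
             , girth⇒nonAveraging girth 2 3F refl (λ ()) (λ ()) (q∤≤3 2 (s≤s (s≤s z≤n))) (q∤≤3 3 ≤-refl))
    (uncurry λ na₁ na₂ → girth≥8 (no-blockRectangle ∘ rectangle⇒blockRectangle)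
                                 (nonAveraging⇒no-blockHexagon na₁ na₂ ∘ hexagon⇒blockHexagon))

corollary2 : (q : ℕ) → Prime q → ¬ (2 ∣ q) →
    (s : ℕ) → 1 ≤ s → s < q →
    (a : Fin 4 → ℕ) → (∀ i → a i < q) → ProperAP a →
    (m : ℕ) (L : Fin m → Fin q) → StrictlyIncreasing L →
    GirthAtLeast (TannerAdj (ShortenedArray q s a L)) 8
      ⇔ (NonAveraging q (toℕ ∘ L) × NonAveraging[ 2 ] q (toℕ ∘ L))
corollary2 _ isPrime _ _ 1≤s s<q _ a<q ap _ _ L-increasing =
  ProperArrayCode.girth≥8⇔nonAveraging isPrime 1≤s s<q a<q ap L-increasing
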